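{- Let $q$ be an odd prime power and $n\ge2$ with $(q^n-1)/2$ even. Let $q_0$ be the square-free part (product of the distinct prime divisors) of $q^n-1$, let $m\mid q_0$ and $\beta\in\mathbb{F}_q$. Let $r_1,\dots,r_s$ be divisors of $m$ such that $\gcd(r_i,r_j)=r_0$ for all $i\neq j$ and $\mathrm{lcm}(r_1,\dots,r_s)=m$. Then $$\mathcal{N}_\beta(m)\ \ge\ \sum_{i=1}^s\mathcal{N}_\beta(r_i)-(s-1)\mathcal{N}_\beta(r_0).$$
   Context: For a divisor $m$ of $q^n-1$, an element $\xi\in\mathbb{F}_{q^n}^*$ is $m$-free if $\xi=\zeta^d$ with $d\mid m$ and $\zeta\in\mathbb{F}_{q^n}^*$ implies $d=1$. $\mathcal{N}_\beta(m)$ is the number of $m$-free $\xi\in\mathbb{F}_{q^n}^*$ with $\mathrm{Tr}(\xi^2)=\beta$, where $\mathrm{Tr}(\xi)=\sum_{i=0}^{n-1}\xi^{q^i}$. -}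

module Defs where

open import Level using (0ℓ)
open import Data.Nat using (ℕ; zero; suc; _^_; _≟_)
open import Data.Nat.Divisibility using (_∣_; _∣?_)
open import Data.Nat.Primality using (Prime; prime?)
open import Data.Nat.LCM using (lcm)
open import Data.Fin using (Fin)
open import Data.List using (List; []; _∷_; upTo; filter; foldr; allFin; length)
open import Data.Nat.ListAction using (product)
open import Data.Bool using (Bool; true; false; _∧_; not)
open import Data.Product using (Σ; ∃; _,_; _×_)
open import Relation.Nullary using (¬_; Dec; does)
open import Relation.Nullary.Decidable using (_×-dec_)
open import Relation.Binary using (Decidable)
open import Relation.Binary.PropositionalEquality using (_≡_)
open import Algebra.Bundles using (CommutativeRing)

record FiniteField : Set₁ where
  field
    cring     : CommutativeRing 0ℓ 0ℓ
  open CommutativeRing cring public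
  field
    _≈?_      : Decidable _≈_
    0≉1       : ¬ (0# ≈ 1#)
    inverse   : ∀ x → ¬ (x ≈ 0#) → ∃ λ y → (x * y) ≈ 1#
    size      : ℕ
    enum      : Fin size → Carrier
    enum-surj : ∀ x → ∃ λ i → enum i ≈ x
    enum-inj  : ∀ i j → enum i ≈ enum j → i ≡ j

module _ (F : FiniteField) where
  open FiniteField F

  pow : Carrier → ℕ → Carrier
  pow x zero    = 1#
  pow x (suc k) = x * pow x k

  -- the prime subfield-sized subfield F_q = { x | x^q = x } (inside F_{q^n})
  InFq : ℕ → Carrier → Set
  InFq q x = pow x q ≈ x

  Tr : ℕ → ℕ → Carrier → Carrier
  Tr q zero    x = 0#
  Tr q (suc i) x = pow x (q ^ i) + Tr q i x

  private
    anyL : {A : Set} → (A → Bool) → List A → Bool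
    anyL p = foldr (λ a b → p a Data.Bool.∨ b) false

    countL : {A : Set} → (A → Bool) → List A → ℕ
    countL p = foldr (λ a k → if p a then suc k else k) 0
      where open import Data.Bool using (if_then_else_)

  -- ξ is m-free: ξ ≠ 0 and whenever ξ = ζ^d with d ∣ m and ζ ∈ F*, d = 1.
  -- (Decided by exhausting d ∈ {0..m} and ζ over the enumeration of F.)
  isFree : ℕ → Carrier → Bool
  isFree m ξ =
    not (does (ξ ≈? 0#)) ∧
    not (anyL (λ d → does (d ∣? m) ∧ not (does (d ≟ 1)) ∧
                     anyL (λ j → not (does (enum j ≈? 0#)) ∧ does (ξ ≈? pow (enum j) d))
                          (allFin size))
              (upTo (suc m)))

  N : (q n : ℕ) → Carrier → ℕ → ℕ
  N q n β m = countL (λ i → isFree m (enum i) ∧ does (Tr q n (enum i * enum i) ≈? β))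
                     (allFin size)

radical : ℕ → ℕ
radical x = product (filter (λ p → prime? p ×-dec p ∣? x) (upTo (suc x)))

lcmFam : (s : ℕ) → (Fin s → ℕ) → ℕ
lcmFam zero    r = 1
lcmFam (suc s) r = lcm (r Fin.zero) (lcmFam s (λ i → r (Fin.suc i)))
  where import Data.Fin as Fin

-- For ξ ≠ 0, being k-free means not being a d-th power for any divisor d ≠ 1 of k. So
-- k-freeness passes to divisors of k, and for s ≥ 2 each A_i = {ξ : ξ r_i-free, Tr(ξ²) = β}
-- lies in A_0, since r₀ = gcd(r_i, r_j) divides r_i. Conversely, a d-th power with
-- 1 ≠ d ∣ lcm(r_i) is a g-th power for g = gcd(d, r_i) ≠ 1 and some i, so ⋂ A_i ⊆ A_m.
-- Hence Σ_i [ξ ∈ A_i] ≤ (s - 1)[ξ ∈ A_0] + [ξ ∈ A_m] pointwise; sum over the field.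
module Submission where

open import Defs
open import Data.Nat using (ℕ; suc; _+_; _*_; _∸_; _^_; _≤_; _≥_; _/_)
open import Data.Nat.Divisibility using (_∣_)
open import Data.Nat.Primality using (Prime)
open import Data.Nat.GCD using (gcd)
open import Data.Fin using (Fin)
open import Data.Product using (∃; ∃₂; _×_)
open import Relation.Nullary using (¬_)
open import Relation.Binary.PropositionalEquality using (_≡_; _≢_)
open import Data.Integer using (ℤ; +_) renaming (_+_ to _+ℤ_; _-_ to _-ℤ_; _*_ to _*ℤ_; _≥_ to _≥ℤ_)
open import Data.Nat.ListAction using (sum)
open import Data.List using (map; allFin)

open import Data.Bool using (Bool; true; false; T; _∨_; if_then_else_)
open import Data.Bool.ListAction using (any)
open import Data.Empty using (⊥-elim)
open import Data.Fin using (zero; suc; fromℕ<)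
open import Data.Integer using (_⊖_) renaming (_≤_ to _≤ℤ_)
open import Data.Integer.Properties as ℤ using (pos-*; [+m]-[+n]≡m⊖n; ⊖-monoˡ-≤; ≤-⊖)
open import Data.List using (List; []; _∷_; foldr; upTo; tabulate)
open import Data.List.Membership.Propositional using (find; lose)
open import Data.List.Membership.Propositional.Properties using (∈-upTo⁺; ∈-allFin)
open import Data.List.Relation.Unary.All as All using ()
open import Data.List.Relation.Unary.All.Properties using (all-filter)
open import Data.List.Relation.Unary.Any using (Any)
open import Data.List.Relation.Unary.Any.Properties using (any⇔)
open import Data.Nat using (zero; z≤n; s≤s; _≟_; NonZero; ≢-nonZero; ≢-nonZero⁻¹)
open import Data.Nat.Coprimality using (gcd≡1⇒coprime; coprime-divisor)
open import Data.Nat.Divisibility using (_∣?_; divides; ∣-trans; ∣⇒≤; ∣1⇒≡1; 0∣⇒≡0; m∣m*n; n∣m*n)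
open import Data.Nat.GCD using (gcd[m,n]∣m; gcd[m,n]∣n)
open import Data.Nat.LCM using (lcm; lcm-least)
open import Data.Nat.Primality using (prime?; productOfPrimes≢0)
open import Data.Nat.Properties as ℕ using (+-*-semiring)
open import Data.Nat.Solver using (module +-*-Solver)
open import Data.Product using (_,_; proj₁; proj₂)
open import Function using (_∘_; _⇔_; Equivalence)
import Relation.Binary.PropositionalEquality as Eq
open Eq using (cong; cong₂; subst)
open import Relation.Nullary using (Dec; does; _because_; yes; no; ¬?)
open import Relation.Nullary.Decidable using (T?; _×-dec_)
open import Relation.Nullary.Reflects using (invert)
open import Algebra.Properties.Semiring.Sum +-*-semiring
  using (sum-syntax; sum-cong-≗; sum-replicate-zero; ∑-distrib-+)

open Equivalence using (to; from)

does-sound : {A : Set} (a? : Dec A) → T (does a?) → A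
does-sound (true because [a]) _ = invert [a]

does-complete : {A : Set} (a? : Dec A) → A → T (does a?)
does-complete (true  because _)    _ = _
does-complete (false because [¬a]) a = invert [¬a] a

anyᵇ : {A : Set} → (A → Bool) → List A → Bool
anyᵇ p = foldr (λ a b → p a ∨ b) false

anyᵇ≡any : {A : Set} (p : A → Bool) (xs : List A) → anyᵇ p xs ≡ any p xs
anyᵇ≡any p []       = Eq.refl
anyᵇ≡any p (x ∷ xs) = cong (p x ∨_) (anyᵇ≡any p xs)

anyᵇ⇔ : {A : Set} {p : A → Bool} (xs : List A) → Any (T ∘ p) xs ⇔ T (anyᵇ p xs)
anyᵇ⇔ {p = p} xs = subst (λ b → Any (T ∘ p) xs ⇔ T b) (Eq.sym (anyᵇ≡any p xs)) any⇔

nonZero-∣ : ∀ {m n} → m ∣ n → .{{NonZero n}} → NonZero m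
nonZero-∣ {n = n} m∣n = ≢-nonZero λ m≡0 → ≢-nonZero⁻¹ n (0∣⇒≡0 (subst (_∣ n) m≡0 m∣n))

radical-nonZero : ∀ x → NonZero (radical x)
radical-nonZero x = productOfPrimes≢0 (All.map proj₁ (all-filter (λ p → prime? p ×-dec p ∣? x) (upTo (suc x))))

lcm∣* : ∀ a b → lcm a b ∣ a * b
lcm∣* a b = lcm-least (m∣m*n {a} b) (n∣m*n a {b})

lcmFam-nontrivial-gcd : ∀ s (r : Fin s → ℕ) {d} → d ∣ lcmFam s r → d ≢ 1 → ∃ λ i → gcd d (r i) ≢ 1
lcmFam-nontrivial-gcd zero    r d∣1 d≢1 = ⊥-elim (d≢1 (∣1⇒≡1 d∣1))
lcmFam-nontrivial-gcd (suc s) r {d} d∣lcm d≢1 with gcd d (r zero) ≟ 1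
... | no  g≢1 = zero , g≢1
... | yes g≡1 = let i , g≢1 = lcmFam-nontrivial-gcd s (r ∘ suc) d∣lcm′ d≢1 in suc i , g≢1
  where
  d∣lcm′ : d ∣ lcmFam s (r ∘ suc)
  d∣lcm′ = coprime-divisor (gcd≡1⇒coprime g≡1) (∣-trans d∣lcm (lcm∣* (r zero) (lcmFam s (r ∘ suc))))

module FreeElements (F : FiniteField) where
  open FiniteField F
    using (Carrier; _≈_; _≈?_; 0#; semiring; setoid; zeroˡ; sym; trans; enum; enum-surj; size)
    renaming (_*_ to _·_)
  open import Algebra.Properties.Semiring.Exp semiring using (^-assocʳ; ^-congˡ) renaming (_^_ to _^ᴿ_)
  open import Relation.Binary.Reasoning.Setoid setoid

  pow≡^ᴿ : ∀ x k → pow F x k ≡ x ^ᴿ k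
  pow≡^ᴿ x zero    = Eq.refl
  pow≡^ᴿ x (suc k) = cong (x ·_) (pow≡^ᴿ x k)

  pow-congˡ : ∀ {x y} k → x ≈ y → pow F x k ≈ pow F y k
  pow-congˡ {x} {y} k x≈y = begin
    pow F x k ≡⟨ pow≡^ᴿ x k ⟩
    x ^ᴿ k    ≈⟨ ^-congˡ k x≈y ⟩
    y ^ᴿ k    ≡⟨ Eq.sym (pow≡^ᴿ y k) ⟩
    pow F y k ∎

  pow-*-assoc : ∀ x k g → pow F (pow F x k) g ≈ pow F x (k * g)
  pow-*-assoc x k g = begin
    pow F (pow F x k) g ≡⟨ pow≡^ᴿ (pow F x k) g ⟩
    pow F x k ^ᴿ g      ≡⟨ cong (_^ᴿ g) (pow≡^ᴿ x k) ⟩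
    (x ^ᴿ k) ^ᴿ g       ≈⟨ ^-assocʳ x k g ⟩
    x ^ᴿ (k * g)        ≡⟨ Eq.sym (pow≡^ᴿ x (k * g)) ⟩
    pow F x (k * g)     ∎

  pow-0# : ∀ k → .{{NonZero k}} → pow F 0# k ≈ 0#
  pow-0# (suc k) = zeroˡ _

  ProperPower : ℕ → Carrier → Set
  ProperPower m ξ = ∃ λ d → d ∣ m × d ≢ 1 × ∃ λ ζ → ξ ≈ pow F ζ d

  ProperPower-∣ : ∀ {a b ξ} → a ∣ b → ProperPower a ξ → ProperPower b ξ
  ProperPower-∣ a∣b (d , d∣a , rest) = d , ∣-trans d∣a a∣b , rest

  ProperPower-lcmFam : ∀ s (r : Fin s → ℕ) {ξ} → ProperPower (lcmFam s r) ξ → ∃ λ i → ProperPower (r i) ξ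
  ProperPower-lcmFam s r {ξ} (d , d∣lcm , d≢1 , ζ , ξ≈ζ^d) with lcmFam-nontrivial-gcd s r d∣lcm d≢1
  ... | i , g≢1 with gcd[m,n]∣m d (r i)
  ... | divides k d≡k*g = i , gcd d (r i) , gcd[m,n]∣n d (r i) , g≢1 , pow F ζ k , (begin
    ξ                               ≈⟨ ξ≈ζ^d ⟩
    pow F ζ d                       ≡⟨ cong (pow F ζ) d≡k*g ⟩
    pow F ζ (k * gcd d (r i))       ≈⟨ sym (pow-*-assoc ζ k (gcd d (r i))) ⟩
    pow F (pow F ζ k) (gcd d (r i)) ∎)

  root? : (ξ : Carrier) (d : ℕ) (j : Fin size) → Dec (¬ enum j ≈ 0# × ξ ≈ pow F (enum j) d)
  root? ξ d j = ¬? (enum j ≈? 0#) ×-dec (ξ ≈? pow F (enum j) d)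

  divisorPower? : (m : ℕ) (ξ : Carrier) (d : ℕ) →
                  Dec (d ∣ m × d ≢ 1 × T (anyᵇ (does ∘ root? ξ d) (allFin size)))
  divisorPower? m ξ d = d ∣? m ×-dec ¬? (d ≟ 1) ×-dec T? _

  properPowerᵇ : ℕ → Carrier → Bool
  properPowerᵇ m ξ = anyᵇ (does ∘ divisorPower? m ξ) (upTo (suc m))

  -- does (free? m ξ) reduces to isFree F m ξ (anyᵇ is the fold used in Defs), so does-sound
  -- and does-complete unpack isFree.
  free? : (m : ℕ) (ξ : Carrier) → Dec (¬ ξ ≈ 0# × ¬ T (properPowerᵇ m ξ))
  free? m ξ = ¬? (ξ ≈? 0#) ×-dec ¬? (T? _)

  properPowerᵇ-sound : ∀ {m ξ} → T (properPowerᵇ m ξ) → ProperPower m ξ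
  properPowerᵇ-sound {m} {ξ} t with find (from (anyᵇ⇔ (upTo (suc m))) t)
  ... | d , _ , td with does-sound (divisorPower? m ξ d) td
  ... | d∣m , d≢1 , tp with find (from (anyᵇ⇔ (allFin size)) tp)
  ... | j , _ , tj = d , d∣m , d≢1 , enum j , proj₂ (does-sound (root? ξ d j) tj)

  properPowerᵇ-complete : ∀ {m ξ} → .{{NonZero m}} → ¬ ξ ≈ 0# → ProperPower m ξ → T (properPowerᵇ m ξ)
  properPowerᵇ-complete {m} {ξ} ξ≉0 (d , d∣m , d≢1 , ζ , ξ≈ζ^d) with enum-surj ζ
  ... | j , enumj≈ζ = to (anyᵇ⇔ (upTo (suc m))) (lose (∈-upTo⁺ (s≤s (∣⇒≤ d∣m)))
      (does-complete (divisorPower? m ξ d) (d∣m , d≢1 , to (anyᵇ⇔ (allFin size)) (lose (∈-allFin j)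
        (does-complete (root? ξ d j) (enumj≉0 , trans ξ≈ζ^d (pow-congˡ d (sym enumj≈ζ))))))))
    where
    instance
      d≢0 : NonZero d
      d≢0 = nonZero-∣ d∣m
    enumj≉0 : ¬ enum j ≈ 0#
    enumj≉0 enumj≈0 = ξ≉0 (begin
      ξ          ≈⟨ ξ≈ζ^d ⟩
      pow F ζ d  ≈⟨ pow-congˡ d (trans (sym enumj≈ζ) enumj≈0) ⟩
      pow F 0# d ≈⟨ pow-0# d ⟩
      0#         ∎)

  isFree-intro : ∀ {m ξ} → ¬ ξ ≈ 0# → ¬ ProperPower m ξ → T (isFree F m ξ)
  isFree-intro {m} {ξ} ξ≉0 ¬pp = does-complete (free? m ξ) (ξ≉0 , ¬pp ∘ properPowerᵇ-sound)

  isFree-elim : ∀ {m ξ} → .{{NonZero m}} → T (isFree F m ξ) → ¬ ξ ≈ 0# × ¬ ProperPower m ξ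
  isFree-elim {m} {ξ} t with does-sound (free? m ξ) t
  ... | ξ≉0 , ¬ppᵇ = ξ≉0 , ¬ppᵇ ∘ properPowerᵇ-complete ξ≉0

  isFree-antitone : ∀ {a b ξ} → .{{NonZero b}} → a ∣ b → T (isFree F b ξ) → T (isFree F a ξ)
  isFree-antitone a∣b t with isFree-elim t
  ... | ξ≉0 , ¬pp = isFree-intro ξ≉0 (¬pp ∘ ProperPower-∣ a∣b)

  isFree-lcmFam : ∀ s (r : Fin s → ℕ) {ξ} → (∀ i → NonZero (r i)) → Fin s →
                  (∀ i → T (isFree F (r i) ξ)) → T (isFree F (lcmFam s r) ξ)
  isFree-lcmFam s r {ξ} r≢0 i₀ free = isFree-intro (proj₁ (elim i₀)) λ pp →
    let i , ppᵢ = ProperPower-lcmFam s r pp in proj₂ (elim i) ppᵢ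
    where
    elim : ∀ i → ¬ ξ ≈ 0# × ¬ ProperPower (r i) ξ
    elim i = isFree-elim {{r≢0 i}} (free i)

indicator : Bool → ℕ
indicator b = if b then 1 else 0

indicator-mono : ∀ {a b} → (T a → T b) → indicator a ≤ indicator b
indicator-mono {false}         _   = z≤n
indicator-mono {true} {true}   _   = ℕ.≤-refl
indicator-mono {true} {false} a⇒b = ⊥-elim (a⇒b _)

indicator-false : ∀ {b} → ¬ T b → indicator b ≡ 0
indicator-false {true}  ¬b = ⊥-elim (¬b _)
indicator-false {false} _  = Eq.refl

∑-indicator-≡0 : ∀ {n} (g : Fin n → Bool) → (∀ i → ¬ T (g i)) → ∑[ i < n ] indicator (g i) ≡ 0
∑-indicator-≡0 {n} g ¬g = Eq.trans (sum-cong-≗ (λ i → indicator-false (¬g i))) (sum-replicate-zero n)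

∑-indicator-≤ : ∀ n (g : Fin (suc n) → Bool) {b} → ((∀ i → T (g i)) → T b) →
                ∑[ i < suc n ] indicator (g i) ≤ n + indicator b
∑-indicator-≤ zero g all⇒b =
  ℕ.≤-trans (ℕ.≤-reflexive (ℕ.+-identityʳ _)) (indicator-mono λ g₀ → all⇒b λ { zero → g₀ })
∑-indicator-≤ (suc n) g {b} all⇒b with g zero in g₀≡
... | true  = s≤s (∑-indicator-≤ n (g ∘ suc) λ all′ → all⇒b λ
                    { zero → subst T (Eq.sym g₀≡) _ ; (suc i) → all′ i })
... | false = begin
  ∑[ i < suc n ] indicator (g (suc i)) ≤⟨ ∑-indicator-≤ n (g ∘ suc) {true} _ ⟩
  n + 1                                ≡⟨ ℕ.+-comm n 1 ⟩
  suc n                                ≤⟨ ℕ.m≤m+n (suc n) (indicator b) ⟩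
  suc n + indicator b                  ∎
  where open ℕ.≤-Reasoning

sieve-indicator : ∀ s (g : Fin s → Bool) {b₀ b} →
                  (∀ i j → i ≢ j → T (g i) → T b₀) → ((∀ i → T (g i)) → T b) →
                  ∑[ i < s ] indicator (g i) ≤ (s ∸ 1) * indicator b₀ + indicator b
sieve-indicator zero          g _ _ = z≤n
sieve-indicator (suc zero)    g _ all⇒b = ∑-indicator-≤ zero g all⇒b
sieve-indicator (suc (suc n)) g {true} {b} _ all⇒b =
  subst (λ k → ∑[ i < suc (suc n) ] indicator (g i) ≤ k + indicator b) (Eq.sym (ℕ.*-identityʳ (suc n)))
        (∑-indicator-≤ (suc n) g all⇒b)
sieve-indicator (suc (suc n)) g {false} ⇒b₀ _ =
  ℕ.≤-trans (ℕ.≤-reflexive (∑-indicator-≡0 g λ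
    { zero → ⇒b₀ zero (suc zero) (λ ()) ; (suc i) → ⇒b₀ (suc i) zero (λ ()) })) z≤n

-- The fold Defs uses for N, so N F q n β k is a count over allFin size definitionally.
count : {A : Set} → (A → Bool) → List A → ℕ
count p = foldr (λ a k → if p a then suc k else k) 0

count-∷ : {A : Set} (p : A → Bool) (x : A) (xs : List A) → count p (x ∷ xs) ≡ indicator (p x) + count p xs
count-∷ p x xs with p x
... | true  = Eq.refl
... | false = Eq.refl

sieve-count : {A : Set} (s : ℕ) (f : Fin s → A → Bool) (f₀ f∩ : A → Bool) →
              (∀ x i j → i ≢ j → T (f i x) → T (f₀ x)) → (∀ x → (∀ i → T (f i x)) → T (f∩ x)) →
              ∀ xs → ∑[ i < s ] count (f i) xs ≤ (s ∸ 1) * count f₀ xs + count f∩ xs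
sieve-count s f f₀ f∩ in₀ in∩ [] = ℕ.≤-trans (ℕ.≤-reflexive (sum-replicate-zero s)) z≤n
sieve-count s f f₀ f∩ in₀ in∩ (x ∷ xs) = begin
  ∑[ i < s ] count (f i) (x ∷ xs)
    ≡⟨ sum-cong-≗ (λ i → count-∷ (f i) x xs) ⟩
  ∑[ i < s ] (indicator (f i x) + count (f i) xs)
    ≡⟨ ∑-distrib-+ (λ i → indicator (f i x)) (λ i → count (f i) xs) ⟩
  ∑[ i < s ] indicator (f i x) + ∑[ i < s ] count (f i) xs
    ≤⟨ ℕ.+-mono-≤ (sieve-indicator s (λ i → f i x) (in₀ x) (in∩ x)) (sieve-count s f f₀ f∩ in₀ in∩ xs) ⟩
  ((s ∸ 1) * indicator (f₀ x) + indicator (f∩ x)) + ((s ∸ 1) * count f₀ xs + count f∩ xs)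
    ≡⟨ solve 5 (λ c a b d e → (c :* a :+ b) :+ (c :* d :+ e) := c :* (a :+ d) :+ (b :+ e))
               Eq.refl (s ∸ 1) (indicator (f₀ x)) (indicator (f∩ x)) (count f₀ xs) (count f∩ xs) ⟩
  (s ∸ 1) * (indicator (f₀ x) + count f₀ xs) + (indicator (f∩ x) + count f∩ xs)
    ≡⟨ Eq.sym (cong₂ (λ a b → (s ∸ 1) * a + b) (count-∷ f₀ x xs) (count-∷ f∩ x xs)) ⟩
  (s ∸ 1) * count f₀ (x ∷ xs) + count f∩ (x ∷ xs) ∎
  where
  open ℕ.≤-Reasoning
  open +-*-Solver

sum-map-tabulate : {A : Set} (n : ℕ) (h : A → ℕ) (f : Fin n → A) → sum (map h (tabulate f)) ≡ ∑[ i < n ] h (f i)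
sum-map-tabulate zero    h f = Eq.refl
sum-map-tabulate (suc n) h f = cong (λ k → h (f zero) + k) (sum-map-tabulate n h (f ∘ suc))

m≤n+o⇒+m-+n≤+o : ∀ {m n o} → m ≤ n + o → + m -ℤ + n ≤ℤ + o
m≤n+o⇒+m-+n≤+o {m} {n} {o} m≤n+o = begin
  + m -ℤ + n    ≡⟨ [+m]-[+n]≡m⊖n m n ⟩
  m ⊖ n         ≤⟨ ⊖-monoˡ-≤ n m≤n+o ⟩
  (n + o) ⊖ n   ≡⟨ ≤-⊖ (ℕ.m≤m+n n o) ⟩
  + (n + o ∸ n) ≡⟨ cong +_ (ℕ.m+n∸m≡n n o) ⟩
  + o           ∎
  where open ℤ.≤-Reasoning

proposition5p9 :
  (F : FiniteField) (q n : ℕ) →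
  (∃₂ λ p k → Prime p × q ≡ p ^ suc k) → ¬ (2 ∣ q) →
  2 ≤ n → 2 ∣ ((q ^ n ∸ 1) / 2) →
  FiniteField.size F ≡ q ^ n →
  (m : ℕ) → m ∣ radical (q ^ n ∸ 1) →
  (β : FiniteField.Carrier F) → InFq F q β →
  (s : ℕ) → 1 ≤ s → (r : Fin s → ℕ) → (r₀ : ℕ) →
  (∀ i → r i ∣ m) →
  (∀ i j → i ≢ j → gcd (r i) (r j) ≡ r₀) →
  lcmFam s r ≡ m →
  (+ N F q n β m) ≥ℤ
    (+ sum (map (λ i → N F q n β (r i)) (allFin s))
      -ℤ (+ (s ∸ 1)) *ℤ (+ N F q n β r₀))
proposition5p9 F q n _ _ _ _ _ m m∣rad β _ s 1≤s r r₀ r∣m gcd≡r₀ lcm≡m =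
  subst (λ k → + sum (map (N F q n β ∘ r) (allFin s)) -ℤ k ≤ℤ + N F q n β m) (pos-* (s ∸ 1) (N F q n β r₀))
    (m≤n+o⇒+m-+n≤+o (begin
      sum (map (N F q n β ∘ r) (allFin s)) ≡⟨ sum-map-tabulate s (N F q n β ∘ r) (λ i → i) ⟩
      ∑[ i < s ] N F q n β (r i)          ≤⟨ sieve-count s (freeTr ∘ r) (freeTr r₀) (freeTr m) inA₀ inAₘ (allFin size) ⟩
      (s ∸ 1) * N F q n β r₀ + N F q n β m ∎))
  where
  open ℕ.≤-Reasoning
  open FiniteField F using (_≈_; _≈?_; enum; size) renaming (_*_ to _·_)
  open FreeElements F

  freeTr? : (k : ℕ) (x : Fin size) → Dec (T (isFree F k (enum x)) × Tr F q n (enum x · enum x) ≈ β)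
  freeTr? k x = T? (isFree F k (enum x)) ×-dec (Tr F q n (enum x · enum x) ≈? β)

  freeTr : ℕ → Fin size → Bool
  freeTr k x = does (freeTr? k x)

  instance
    m≢0 : NonZero m
    m≢0 = nonZero-∣ m∣rad {{radical-nonZero (q ^ n ∸ 1)}}

  r≢0 : ∀ i → NonZero (r i)
  r≢0 i = nonZero-∣ (r∣m i)

  inA₀ : ∀ x i j → i ≢ j → T (freeTr (r i) x) → T (freeTr r₀ x)
  inA₀ x i j i≢j t with does-sound (freeTr? (r i) x) t
  ... | free , trace = does-complete (freeTr? r₀ x) (isFree-antitone {{r≢0 i}} r₀∣rᵢ free , trace)
    where
    r₀∣rᵢ : r₀ ∣ r i
    r₀∣rᵢ = subst (_∣ r i) (gcd≡r₀ i j i≢j) (gcd[m,n]∣m (r i) (r j))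

  inAₘ : ∀ x → (∀ i → T (freeTr (r i) x)) → T (freeTr m x)
  inAₘ x t = does-complete (freeTr? m x)
    (subst (λ k → T (isFree F k (enum x))) lcm≡m (isFree-lcmFam s r r≢0 i₀ (proj₁ ∘ unpack)) , proj₂ (unpack i₀))
    where
    i₀ : Fin s
    i₀ = fromℕ< 1≤s
    unpack : ∀ i → T (isFree F (r i) (enum x)) × Tr F q n (enum x · enum x) ≈ β
    unpack i = does-sound (freeTr? (r i) x) (t i)
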